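{- Let $T$ be a non-unary string with $m$ runs, and let $i\le j$ be run indices with $j>\sqrt{m}$. If the shortest border of $T[\mathrm{Beg}(i)..\mathrm{End}(j)]$ has RLE size greater than $\sqrt{m}$, then $S_j$ is a suffix of every border of $T[\mathrm{Beg}(i)..\mathrm{End}(j)]$.
   Context: Let $R_1,\dots,R_m$ be the maximal character runs of $T$ with beginning and ending positions $\mathrm{Beg}(\cdot)$ and $\mathrm{End}(\cdot)$. The RLE size $r(w)$ of a string $w$ is its number of maximal runs. A border of $w$ is a non-empty string that is both a proper prefix and a proper suffix; the border of $w$ means its longest border. The RLE pseudo period of a string $w$ is $\mathit{pp}(w)=r(w)-b$, where $b$ is the RLE size of the longest border of $w$ ($b=0$ if $w$ has no border). Let $\$$ be a character not occurring in $T$. For $j>\sqrt{m}$, $S_j$ is the longer of (1) the shortest suffix of $\$T[1..\mathrm{End}(j)]$ whose RLE pseudo period is greater than $\sqrt{m}/2-1$, and (2) $T[\mathrm{Beg}(j-\sqrt{m}+1)..\mathrm{End}(j)]$. -}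

module Defs where

open import Data.Nat using (ℕ; zero; suc; _+_; _*_; _∸_; _≤_; _<_)
open import Data.Nat.Properties using (_≤?_)
open import Data.List using (List; []; _∷_; _++_; length; take; drop; map)
open import Data.Nat.ListAction using (sum)
import Data.List.Properties as LP
open import Data.Maybe using (Maybe; just; nothing)
open import Data.Product using (Σ; ∃; _×_; _,_)
open import Relation.Nullary using (¬_; yes; no)
open import Relation.Binary.Definitions using (DecidableEquality)
open import Relation.Binary.PropositionalEquality using (_≡_)

-- Strings over an alphabet with decidable equality are lists; positions are 1-based.

incHead : List ℕ → List ℕ
incHead []       = 1 ∷ []
incHead (n ∷ ns) = suc n ∷ ns

runLengthsFrom : {B : Set} → DecidableEquality B → B → List B → List ℕ
runLengthsFrom eq x []       = 1 ∷ []
runLengthsFrom eq x (y ∷ ys) with eq x y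
... | yes _ = incHead (runLengthsFrom eq y ys)
... | no  _ = 1 ∷ runLengthsFrom eq y ys

runLengths : {B : Set} → DecidableEquality B → List B → List ℕ
runLengths eq []       = []
runLengths eq (x ∷ xs) = runLengthsFrom eq x xs

rle : {B : Set} → DecidableEquality B → List B → ℕ
rle eq w = length (runLengths eq w)

End : {B : Set} → DecidableEquality B → List B → ℕ → ℕ
End eq T k = sum (take k (runLengths eq T))

Beg : {B : Set} → DecidableEquality B → List B → ℕ → ℕ
Beg eq T k = suc (End eq T (k ∸ 1))

-- substring T[p..q] (1-based, inclusive)
sub : {B : Set} → List B → ℕ → ℕ → List B
sub T p q = drop (p ∸ 1) (take q T)

IsPrefix : {B : Set} → List B → List B → Set
IsPrefix {B} u w = Σ (List B) λ v → u ++ v ≡ w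

IsSuffix : {B : Set} → List B → List B → Set
IsSuffix {B} u w = Σ (List B) λ v → v ++ u ≡ w

IsBorder : {B : Set} → List B → List B → Set
IsBorder u w = ¬ (u ≡ []) × length u < length w × IsPrefix u w × IsSuffix u w

IsShortestBorder : {B : Set} → List B → List B → Set
IsShortestBorder {B} u w = IsBorder u w × ((u' : List B) → IsBorder u' w → length u ≤ length u')

longestBorder : {B : Set} → DecidableEquality B → List B → List B
longestBorder {B} eq w = go (length w ∸ 1)
  where
  go : ℕ → List B
  go zero    = []
  go (suc k) with LP.≡-dec eq (take (suc k) w) (drop (length w ∸ suc k) w)
  ... | yes _ = take (suc k) w
  ... | no  _ = go k

pp : {B : Set} → DecidableEquality B → List B → ℕ
pp eq w = rle eq w ∸ rle eq (longestBorder eq w)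

longer : {B : Set} → List B → List B → List B
longer u v with length u ≤? length v
... | yes _ = v
... | no  _ = u

{-# OPTIONS --safe #-}
-- The shortest border B₀ of w = T[Beg(i)..End(j)] is unbordered, so pp(B₀) = r(B₀) > s and B₀,
-- a suffix of $T[1..End(j)], competes in the definition of S₁; by minimality S₁ is no longer
-- than B₀. Suffixes of one string are ordered by length, and B₀ is a suffix of every border B of
-- w, so S₁ is a suffix of B. The factor T[Beg(j-s+1)..End(j)] consists of at most s runs, while
-- r(B) ≥ r(B₀) > s; so it is shorter than B and hence a suffix of B as well.
module Submission where

open import Defs
open import Data.Nat using (ℕ; zero; suc; _+_; _*_; _∸_; _≤_; _<_; z≤n; s≤s)
open import Data.Nat.Properties
  using (≤-refl; ≤-reflexive; ≤-trans; <-trans; ≤-<-trans; <-≤-trans; <⇒≤; <⇒≱; ≰⇒>; _≤?_;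
         n≤1+n; m≤n⇒m≤1+n; m≤m+n; m≤n*m; +-comm; m⊓n≤m; m≤n⇒m⊓n≡m; m∸n≤m; ∸-monoˡ-≤;
         m∸[m∸n]≡n; module ≤-Reasoning)
open import Data.Nat.ListAction using (sum)
open import Data.List using (List; []; _∷_; _++_; map; length; take; drop)
open import Data.List.Properties
  using (++-assoc; map-++; length-map; length-++-≤ʳ; map-injective; ∷-injectiveˡ; ∷-injectiveʳ;
         take++drop≡id; length-take; length-drop; take-take; drop-drop; ≡-dec)
open import Data.List.Membership.Propositional using (_∈_)
open import Data.Maybe using (Maybe; just; nothing)
import Data.Maybe.Properties as MP
open import Data.Product using (Σ; ∃; ∃₂; _×_; _,_)
open import Data.Sum using (_⊎_; inj₁; inj₂; [_,_]′)
open import Data.Empty using (⊥-elim)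
open import Function using (id)
open import Function.Definitions using (Injective)
open import Relation.Nullary using (¬_; yes; no; contradiction)
open import Relation.Binary.Definitions using (DecidableEquality)
open import Relation.Binary.PropositionalEquality
  using (_≡_; _≢_; refl; sym; trans; cong; subst; subst₂; module ≡-Reasoning)

private
  variable
    A C : Set
    u v w : List A
    x : A
    xs : List A

suffix-trans : IsSuffix u v → IsSuffix v w → IsSuffix u w
suffix-trans {u = u} (p , refl) (q , refl) = q ++ p , ++-assoc q p u

prefix-trans : IsPrefix u v → IsPrefix v w → IsPrefix u w
prefix-trans {u = u} (p , refl) (q , refl) = p ++ q , sym (++-assoc u p q)

suffix-∷ : IsSuffix u w → IsSuffix u (x ∷ w)
suffix-∷ {x = x} (p , refl) = x ∷ p , refl

map-suffix : (f : A → C) → IsSuffix u w → IsSuffix (map f u) (map f w)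
map-suffix {u = u} f (p , refl) = map f p , sym (map-++ f p u)

drop-suffix : ∀ n (xs : List A) → IsSuffix (drop n xs) xs
drop-suffix n xs = take n xs , take++drop≡id n xs

take-prefix : ∀ n (xs : List A) → IsPrefix (take n xs) xs
take-prefix n xs = drop n xs , take++drop≡id n xs

++-suffix-by-length : ∀ (p q : List A) → p ++ u ≡ q ++ v → length u ≤ length v → IsSuffix u v
++-suffix-by-length p       []      p++u≡v  _  = p , p++u≡v
++-suffix-by-length []      (_ ∷ q) refl    le = contradiction (length-++-≤ʳ _ {q}) (<⇒≱ le)
++-suffix-by-length (_ ∷ p) (_ ∷ q) p++u≡q++v le = ++-suffix-by-length p q (∷-injectiveʳ p++u≡q++v) le

suffix-of-suffix-by-length : IsSuffix u w → IsSuffix v w → length u ≤ length v → IsSuffix u v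
suffix-of-suffix-by-length (p , p++u≡w) (q , q++v≡w) =
  ++-suffix-by-length p q (trans p++u≡w (sym q++v≡w))

Unbordered : List A → Set
Unbordered {A} w = (u : List A) → ¬ IsBorder u w

border-suffix : IsBorder u w → IsSuffix u w
border-suffix (_ , _ , _ , u⊑w) = u⊑w

border-trans : IsBorder u v → IsBorder v w → IsBorder u w
border-trans (u≢[] , u<v , u≤v , u⊑v) (_ , v<w , v≤w , v⊑w) =
  u≢[] , <-trans u<v v<w , prefix-trans u≤v v≤w , suffix-trans u⊑v v⊑w

shortestBorder-unbordered : IsShortestBorder u w → Unbordered u
shortestBorder-unbordered (u-border , u-shortest) v v-border@(_ , v<u , _) =
  <⇒≱ v<u (u-shortest v (border-trans v-border u-border))

shortestBorder-suffix : IsShortestBorder u w → IsBorder v w → IsSuffix u v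
shortestBorder-suffix (u-border , u-shortest) v-border =
  suffix-of-suffix-by-length (border-suffix u-border) (border-suffix v-border) (u-shortest _ v-border)

map-++⁻ : ∀ (f : A → C) (u v : List C) (w : List A) → u ++ v ≡ map f w →
          ∃₂ λ u′ v′ → u ≡ map f u′ × v ≡ map f v′ × u′ ++ v′ ≡ w
map-++⁻ f []      v w       v≡fw   = [] , w , refl , v≡fw , refl
map-++⁻ f (_ ∷ u) v (x ∷ w) u++v≡fw with map-++⁻ f u v w (∷-injectiveʳ u++v≡fw)
... | u′ , v′ , refl , refl , refl = x ∷ u′ , v′ , cong (_∷ _) (∷-injectiveˡ u++v≡fw) , refl , refl

border-map⁻ : {f : A → C} → Injective _≡_ _≡_ f → {u : List C} →
              IsBorder u (map f w) → ∃ λ u′ → IsBorder u′ w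
border-map⁻ {f = f} f-inj (u≢[] , u<fw , (v , u++v≡fw) , (v′ , v′++u≡fw))
  with map-++⁻ f _ v _ u++v≡fw | map-++⁻ f v′ _ _ v′++u≡fw
... | p , p′ , refl , _ , refl | _ , q , _ , fp≡fq , q-suffix
  with refl ← map-injective f-inj fp≡fq =
  p , (λ p≡[] → u≢[] (cong (map f) p≡[])) ,
      subst₂ _<_ (length-map f p) (length-map f (p ++ p′)) u<fw ,
      (_ , refl) , (_ , q-suffix)

map-unbordered : {f : A → C} → Injective _≡_ _≡_ f → Unbordered w → Unbordered (map f w)
map-unbordered f-inj w-unbordered u u-border with border-map⁻ f-inj u-border
... | u′ , u′-border = w-unbordered u′ u′-border

take≡drop⇒border : ∀ k (w : List A) → suc k ≤ length w ∸ 1 →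
                   take (suc k) w ≡ drop (length w ∸ suc k) w → IsBorder (take (suc k) w) w
take≡drop⇒border k (x ∷ w) k<w take≡drop =
  (λ ()) ,
  s≤s (≤-<-trans (≤-trans (≤-reflexive (length-take k w)) (m⊓n≤m k (length w))) k<w) ,
  take-prefix (suc k) (x ∷ w) ,
  subst (λ u → IsSuffix u (x ∷ w)) (sym take≡drop) (drop-suffix (length w ∸ k) (x ∷ w))

-- The search loop of longestBorder is local to its definition and cannot be named here;
-- abstracting over its starting length lets Agda infer the type of search from that use.
mutual
  longestBorder≡[]⊎take≡drop : (eq : DecidableEquality A) (w : List A) →
    longestBorder eq w ≡ [] ⊎
    ∃ λ k → suc k ≤ length w ∸ 1 × take (suc k) w ≡ drop (length w ∸ suc k) w
  longestBorder≡[]⊎take≡drop eq w with length w ∸ 1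
  ... | n = search eq w n

  private
    search : (eq : DecidableEquality A) (w : List A) (n : ℕ) → _
    search eq w zero    = inj₁ refl
    search eq w (suc k) with ≡-dec eq (take (suc k) w) (drop (length w ∸ suc k) w)
    ... | yes take≡drop = inj₂ (k , ≤-refl , take≡drop)
    ... | no  _ with search eq w k
    ...   | inj₁ none                  = inj₁ none
    ...   | inj₂ (k′ , k′<k , take≡drop) = inj₂ (k′ , m≤n⇒m≤1+n k′<k , take≡drop)

longestBorder-unbordered : (eq : DecidableEquality A) → Unbordered w → longestBorder eq w ≡ []
longestBorder-unbordered {w = w} eq w-unbordered =
  [ id , (λ (k , k<w , take≡drop) → ⊥-elim (w-unbordered _ (take≡drop⇒border k w k<w take≡drop))) ]′
  (longestBorder≡[]⊎take≡drop eq w)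

pp-unbordered : (eq : DecidableEquality A) → Unbordered w → pp eq w ≡ rle eq w
pp-unbordered {w = w} eq w-unbordered =
  cong (λ b → rle eq w ∸ rle eq b) (longestBorder-unbordered eq w-unbordered)

module _ (eq : DecidableEquality A) where

  runLengthsFrom-suc : ∀ x xs → ∃₂ λ l ls → runLengthsFrom eq x xs ≡ suc l ∷ ls
  runLengthsFrom-suc x []       = 0 , [] , refl
  runLengthsFrom-suc x (y ∷ ys) with eq x y
  ... | no  _ = 0 , _ , refl
  ... | yes _ with runLengthsFrom-suc y ys
  ...   | l , ls , runs≡ = suc l , ls , cong incHead runs≡

  runLengthsFrom≢[] : runLengthsFrom eq x xs ≢ []
  runLengthsFrom≢[] {x} {xs} runs≡[] with runLengthsFrom-suc x xs
  ... | _ , _ , runs≡ with () ← trans (sym runs≡[]) runs≡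

  runLengthsFrom-≢ : ∀ {y ys} → x ≢ y → runLengthsFrom eq x (y ∷ ys) ≡ 1 ∷ runLengthsFrom eq y ys
  runLengthsFrom-≢ {x} {y} x≢y with eq x y
  ... | yes x≡y = contradiction x≡y x≢y
  ... | no  _   = refl

  runLengthsFrom-≡ : ∀ {ys} → runLengthsFrom eq x (x ∷ ys) ≡ incHead (runLengthsFrom eq x ys)
  runLengthsFrom-≡ {x} with eq x x
  ... | yes _   = refl
  ... | no  x≢x = contradiction refl x≢x

  runLengths-drop-firstRun : ∀ {l ls} → runLengthsFrom eq x xs ≡ l ∷ ls →
                             runLengths eq (drop l (x ∷ xs)) ≡ ls
  runLengths-drop-firstRun {x} {[]}     refl = refl
  runLengths-drop-firstRun {x} {y ∷ ys} runs≡ with eq x y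
  ... | no  _    with refl ← runs≡ = refl
  ... | yes refl with runLengthsFrom-suc x ys
  ...   | _ , _ , runs′≡ with refl ← trans (sym (cong incHead runs′≡)) runs≡ =
    runLengths-drop-firstRun runs′≡

  runLengths-take-firstRun : ∀ {l ls} → runLengthsFrom eq x xs ≡ l ∷ ls → ∀ n →
    runLengths eq (take (l + n) (x ∷ xs)) ≡ l ∷ runLengths eq (take n (drop l (x ∷ xs)))
  runLengths-take-firstRun {x} {[]} refl zero    = refl
  runLengths-take-firstRun {x} {[]} refl (suc n) = refl
  runLengths-take-firstRun {x} {y ∷ ys} runs≡ n with eq x y
  ... | yes refl with runLengthsFrom-suc x ys
  ...   | _ , _ , runs′≡ with refl ← trans (sym (cong incHead runs′≡)) runs≡ =
    trans runLengthsFrom-≡ (cong incHead (runLengths-take-firstRun runs′≡ n))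
  runLengths-take-firstRun {x} {y ∷ ys} refl zero    | no _   = refl
  runLengths-take-firstRun {x} {y ∷ ys} refl (suc _) | no x≢y = runLengthsFrom-≢ x≢y

  runLengths-take : ∀ k (V : List A) {R} → runLengths eq V ≡ R →
                    runLengths eq (take (sum (take k R)) V) ≡ take k R
  runLengths-take zero    V        _     = refl
  runLengths-take (suc k) []       refl  = refl
  runLengths-take (suc k) (x ∷ xs) {[]} runs≡ = contradiction runs≡ (runLengthsFrom≢[] {x} {xs})
  runLengths-take (suc k) (x ∷ xs) {l ∷ ls} runs≡ =
    trans (runLengths-take-firstRun runs≡ _)
          (cong (l ∷_) (runLengths-take k (drop l (x ∷ xs)) (runLengths-drop-firstRun runs≡)))

  runLengths-drop : ∀ k (V : List A) {R} → runLengths eq V ≡ R →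
                    runLengths eq (drop (sum (take k R)) V) ≡ drop k R
  runLengths-drop zero    V        runs≡ = runs≡
  runLengths-drop (suc k) []       refl  = refl
  runLengths-drop (suc k) (x ∷ xs) {[]} runs≡ = contradiction runs≡ (runLengthsFrom≢[] {x} {xs})
  runLengths-drop (suc k) (x ∷ xs) {l ∷ ls} runs≡ =
    trans (cong (runLengths eq) (sym (drop-drop l _ (x ∷ xs))))
          (runLengths-drop k (drop l (x ∷ xs)) (runLengths-drop-firstRun runs≡))

  runLengths-runs : ∀ (T : List A) {k j} → k ≤ j →
    runLengths eq (drop (End eq T k) (take (End eq T j) T)) ≡ drop k (take j (runLengths eq T))
  runLengths-runs T {k} {j} k≤j = begin
    runLengths eq (drop (sum (take k R)) U)          ≡⟨ cong (λ R′ → runLengths eq (drop (sum R′) U)) take-k≡ ⟩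
    runLengths eq (drop (sum (take k (take j R))) U) ≡⟨ runLengths-drop k U (runLengths-take j T refl) ⟩
    drop k (take j R)                                ∎
    where
    open ≡-Reasoning
    R = runLengths eq T
    U = take (End eq T j) T
    take-k≡ : take k R ≡ take k (take j R)
    take-k≡ = sym (trans (take-take k j R) (cong (λ n → take n R) (m≤n⇒m⊓n≡m k≤j)))

  rle-runs : ∀ (T : List A) {k j} → k ≤ j → rle eq (sub T (Beg eq T (suc k)) (End eq T j)) ≤ j ∸ k
  rle-runs T {k} {j} k≤j = begin
    length (runLengths eq (drop (End eq T k) (take (End eq T j) T))) ≡⟨ cong length (runLengths-runs T k≤j) ⟩
    length (drop k (take j R))                                       ≡⟨ length-drop k (take j R) ⟩
    length (take j R) ∸ k                                            ≤⟨ ∸-monoˡ-≤ k length-take-j≤j ⟩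
    j ∸ k                                                            ∎
    where
    open ≤-Reasoning
    R = runLengths eq T
    length-take-j≤j : length (take j R) ≤ j
    length-take-j≤j = ≤-trans (≤-reflexive (length-take j R)) (m⊓n≤m j (length R))

  rle-lastRuns : ∀ (T : List A) {s j} → s ≤ j → rle eq (sub T (Beg eq T (j ∸ s + 1)) (End eq T j)) ≤ s
  rle-lastRuns T {s} {j} s≤j rewrite +-comm (j ∸ s) 1 = begin
    rle eq (sub T (Beg eq T (suc (j ∸ s))) (End eq T j)) ≤⟨ rle-runs T (m∸n≤m j s) ⟩
    j ∸ (j ∸ s)                                          ≡⟨ m∸[m∸n]≡n s≤j ⟩
    s                                                    ∎
    where open ≤-Reasoning

  length≤length-incHead : ∀ ns → length ns ≤ length (incHead ns)
  length≤length-incHead []      = z≤n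
  length≤length-incHead (_ ∷ _) = ≤-refl

  rle-∷ : ∀ x (u : List A) → rle eq u ≤ rle eq (x ∷ u)
  rle-∷ x []       = z≤n
  rle-∷ x (y ∷ ys) with eq x y
  ... | yes _ = length≤length-incHead (runLengthsFrom eq y ys)
  ... | no  _ = n≤1+n _

  rle-suffix : IsSuffix u w → rle eq u ≤ rle eq w
  rle-suffix ([]    , refl) = ≤-refl
  rle-suffix {u} (x ∷ p , refl) = ≤-trans (rle-suffix {u} (p , refl)) (rle-∷ x (p ++ u))

  suffix-of-suffix-by-rle : IsSuffix u w → IsSuffix v w → rle eq u < rle eq v → IsSuffix u v
  suffix-of-suffix-by-rle {u} {w} {v} u⊑w v⊑w u<v with length u ≤? length v
  ... | yes u≤v = suffix-of-suffix-by-length u⊑w v⊑w u≤v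
  ... | no  u≰v = contradiction (rle-suffix (suffix-of-suffix-by-length v⊑w u⊑w (<⇒≤ (≰⇒> u≰v))))
                                (<⇒≱ u<v)

runLengthsFrom-map : (eqA : DecidableEquality A) (eqC : DecidableEquality C) {f : A → C} →
  Injective _≡_ _≡_ f → ∀ x ys → runLengthsFrom eqC (f x) (map f ys) ≡ runLengthsFrom eqA x ys
runLengthsFrom-map eqA eqC         f-inj x []       = refl
runLengthsFrom-map eqA eqC {f = f} f-inj x (y ∷ ys) with eqA x y | eqC (f x) (f y)
... | yes _   | yes _    = cong incHead (runLengthsFrom-map eqA eqC f-inj y ys)
... | no  _   | no  _    = cong (1 ∷_) (runLengthsFrom-map eqA eqC f-inj y ys)
... | yes x≡y | no fx≢fy = contradiction (cong f x≡y) fx≢fy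
... | no  x≢y | yes fx≡fy = contradiction (f-inj fx≡fy) x≢y

rle-map : (eqA : DecidableEquality A) (eqC : DecidableEquality C) {f : A → C} →
  Injective _≡_ _≡_ f → ∀ w → rle eqC (map f w) ≡ rle eqA w
rle-map eqA eqC f-inj []      = refl
rle-map eqA eqC f-inj (x ∷ w) = cong length (runLengthsFrom-map eqA eqC f-inj x w)

pp-just-unbordered : (eq : DecidableEquality A) → Unbordered w →
                     pp (MP.≡-dec eq) (map just w) ≡ rle eq w
pp-just-unbordered {w = w} eq w-unbordered = trans
  (pp-unbordered (MP.≡-dec eq) (map-unbordered MP.just-injective w-unbordered))
  (rle-map eq (MP.≡-dec eq) MP.just-injective w)

longer-elim : (P : List A → Set) → P u → P v → P (longer u v)
longer-elim {u = u} {v = v} P Pu Pv with length u ≤? length v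
... | yes _ = Pv
... | no  _ = Pu

lemma10 : {A : Set} (eq : DecidableEquality A) (T : List A) →
    (Σ A λ x → Σ A λ y → x ∈ T × y ∈ T × ¬ (x ≡ y)) →
    (s : ℕ) → s * s ≤ rle eq T → rle eq T < suc s * suc s →
    (i j : ℕ) → 1 ≤ i → i ≤ j → j ≤ rle eq T → s < j →
    (B₀ : List A) → IsShortestBorder B₀ (sub T (Beg eq T i) (End eq T j)) → s < rle eq B₀ →
    (S₁ : List (Maybe A)) →
    IsSuffix S₁ (nothing ∷ map just (sub T 1 (End eq T j))) →
    s < 2 * pp (MP.≡-dec eq) S₁ + 2 →
    ((S' : List (Maybe A)) → IsSuffix S' (nothing ∷ map just (sub T 1 (End eq T j))) →
      s < 2 * pp (MP.≡-dec eq) S' + 2 → length S₁ ≤ length S') →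
    (B : List A) → IsBorder B (sub T (Beg eq T i) (End eq T j)) →
    IsSuffix (longer S₁ (map just (sub T (Beg eq T (j ∸ s + 1)) (End eq T j)))) (map just B)
lemma10 {A} eq T _ s _ _ i j _ _ _ s<j B₀ B₀-shortest s<rB₀ S₁ S₁⊑$U _ S₁-minimal B B-border =
  longer-elim (λ S → IsSuffix S (map just B)) S₁⊑B (map-suffix just D⊑B)
  where
  U : List A
  U = take (End eq T j) T
  B⊑U : IsSuffix B U
  B⊑U = suffix-trans (border-suffix B-border) (drop-suffix (End eq T (i ∸ 1)) U)
  B₀⊑B : IsSuffix B₀ B
  B₀⊑B = shortestBorder-suffix B₀-shortest B-border
  B₀⊑$U : IsSuffix (map just B₀) (nothing ∷ map just U)
  B₀⊑$U = suffix-∷ (map-suffix just (suffix-trans B₀⊑B B⊑U))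
  B₀-admissible : s < 2 * pp (MP.≡-dec eq) (map just B₀) + 2
  B₀-admissible rewrite pp-just-unbordered eq (shortestBorder-unbordered B₀-shortest) =
    ≤-trans s<rB₀ (≤-trans (m≤n*m _ 2) (m≤m+n _ 2))
  S₁⊑B : IsSuffix S₁ (map just B)
  S₁⊑B = suffix-trans (suffix-of-suffix-by-length S₁⊑$U B₀⊑$U (S₁-minimal _ B₀⊑$U B₀-admissible))
                      (map-suffix just B₀⊑B)
  D⊑B : IsSuffix (sub T (Beg eq T (j ∸ s + 1)) (End eq T j)) B
  D⊑B = suffix-of-suffix-by-rle eq (drop-suffix (End eq T (j ∸ s + 1 ∸ 1)) U) B⊑U
          (≤-<-trans (rle-lastRuns eq T (<⇒≤ s<j)) (<-≤-trans s<rB₀ (rle-suffix eq B₀⊑B)))
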